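{- Let $n\ge2$ and let $\mathcal{H}(n)$ be the group with generators $x_1,\dots,x_n,y_1,\dots,y_n$ and defining relations, for all $x,x'\in X_0=\{x_1,\dots,x_n\}$, $y,y'\in Y_0=\{y_1,\dots,y_n\}$, $z,z',z'',z'''\in X_0\cup Y_0$: $z^2=1$, $[x,x']=[y,y']=1$, $[x,y]^2=1$, $[[y,x],y']=1$, $[[x,y],z]^2=1$, $[[[z,z'],z''],z''']=1$. Then: (1) for all $z,z'\in X_0\cup Y_0$, $[[z,z'],z]=[[z,z'],z']=1$; (2) for all $z,z',z''\in X_0\cup Y_0$, $[[z,z'],z'']\in Z(\mathcal{H}(n))$, $[z,z']=[z',z]$, and $[z,z']^2=[[z,z'],z'']^2=1$; (3) the fourth term $\mathcal{H}(n)_4$ of the lower central series of $\mathcal{H}(n)$ is trivial, so $\mathcal{H}(n)$ is nilpotent of class at most $3$.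
   Context: Commutators: $[a,b]=a^{ -1}b^{ -1}ab$. Lower central series: $G_1=G$, $G_{k+1}=[G_k,G]$. $Z(\cdot)$ is the centre. -}

module Defs where

open import Data.Nat using (ℕ; suc)
open import Data.Fin using (Fin)
open import Data.Sum using (_⊎_; inj₁; inj₂)
open import Data.Bool using (Bool; true; false; not)
open import Data.Product using (_×_; _,_)
open import Data.List using (List; []; _∷_; _++_; map; reverse)

-- Generators of H(n): inj₁ i = x_{i+1}, inj₂ i = y_{i+1}  (the set X₀ ∪ Y₀).
Gen : ℕ → Set
Gen n = Fin n ⊎ Fin n

-- A letter is a generator with an exponent sign (true = +1, false = -1).
Letter : ℕ → Set
Letter n = Gen n × Bool

Word : ℕ → Set
Word n = List (Letter n)

module _ {n : ℕ} where

  flipL : Letter n → Letter n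
  flipL (g , b) = (g , not b)

  ε : Word n
  ε = []

  infixl 7 _·_
  _·_ : Word n → Word n → Word n
  a · b = a ++ b

  inv : Word n → Word n
  inv w = reverse (map flipL w)

  gen : Gen n → Word n
  gen z = (z , true) ∷ []

  X : Fin n → Word n
  X i = gen (inj₁ i)

  Y : Fin n → Word n
  Y i = gen (inj₂ i)

  comm : Word n → Word n → Word n
  comm a b = inv a · inv b · a · b

  sq : Word n → Word n
  sq a = a · a

  data Relator : Word n → Set where
    r-sq   : ∀ z → Relator (sq (gen z))
    r-xx   : ∀ i j → Relator (comm (X i) (X j))
    r-yy   : ∀ i j → Relator (comm (Y i) (Y j))
    r-xy²  : ∀ i j → Relator (sq (comm (X i) (Y j)))
    r-yxy  : ∀ i j k → Relator (comm (comm (Y j) (X i)) (Y k))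
    r-xyz² : ∀ i j z → Relator (sq (comm (comm (X i) (Y j)) (gen z)))
    r-4    : ∀ z z′ z″ z‴ →
             Relator (comm (comm (comm (gen z) (gen z′)) (gen z″)) (gen z‴))

  -- Equality in H(n) = F(X₀ ∪ Y₀) / ⟨⟨relators⟩⟩: the congruence on words
  -- generated by free cancellation and the relators.
  infix 4 _≈_
  data _≈_ : Word n → Word n → Set where
    ≈-refl  : ∀ {a} → a ≈ a
    ≈-sym   : ∀ {a b} → a ≈ b → b ≈ a
    ≈-trans : ∀ {a b c} → a ≈ b → b ≈ c → a ≈ c
    ≈-cong  : ∀ {a a′ b b′} → a ≈ a′ → b ≈ b′ → a · b ≈ a′ · b′
    ≈-free  : ∀ l → (l ∷ flipL l ∷ []) ≈ ε
    ≈-rel   : ∀ {r} → Relator r → r ≈ ε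

  Central : Word n → Set
  Central g = ∀ h → g · h ≈ h · g

  -- Lower central series: LCS k g means g ∈ H(n)_k  (for k ≥ 1),
  -- H_1 = H, H_{k+1} = [H_k, H] = subgroup generated by [g,h], g ∈ H_k, h ∈ H.
  data LCS : ℕ → Word n → Set where
    lcs-whole : ∀ g → LCS 1 g
    lcs-comm  : ∀ {k g} → LCS (suc k) g → ∀ h → LCS (suc (suc k)) (comm g h)
    lcs-unit  : ∀ {k} → LCS k ε
    lcs-mul   : ∀ {k a b} → LCS k a → LCS k b → LCS k (a · b)
    lcs-inv   : ∀ {k a} → LCS k a → LCS k (inv a)
    lcs-resp  : ∀ {k a b} → a ≈ b → LCS k a → LCS k b

{-# OPTIONS --safe #-}
-- The generators are involutions, so [z,z′]⁻¹ = [z′,z]; with the relators this gives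
-- [z,z′]² = 1 and [z,z′] = [z′,z], hence [z,z′]^z = [z′,z] = [z,z′], which is (1).
-- The last relator says that [[z,z′],z″] commutes with every generator, hence is
-- central. Write Z₂ for the second centre, the normal subgroup of those g with
-- [g,h] central for all h. For a normal subgroup N the identity
-- [a,bc] = [a,c]·[a,b]^c shows that [g,h] ∈ N for all h as soon as [g,z] ∈ N for
-- all generators z. Applied with N = Z this puts [z,z′] in Z₂; applied with N = Z₂,
-- first to [z,h] and then (via [h,z] = [z,h]⁻¹) to [h,h′], it puts every
-- commutator in Z₂. Hence H₂ ⊆ Z₂, H₃ ⊆ Z and H₄ = 1.
module Submission where

open import Level using (_⊔_)
open import Data.Nat using (ℕ; suc; _≤_)
open import Data.Product using (_×_; _,_; proj₁)
open import Data.Sum using (inj₁; inj₂)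
open import Data.Bool using (true; false)
open import Data.Bool.Properties using (not-involutive)
open import Data.List using ([]; _∷_; map)
open import Data.List.Properties using (++-assoc; ++-identityʳ; unfold-reverse)
open import Algebra.Bundles using (Group)
open import Relation.Binary.Bundles using (Setoid)
open import Relation.Binary.PropositionalEquality as ≡ using (_≡_)

module CommutatorCalculus {c ℓ} (G : Group c ℓ) where
  open Group G
  open import Algebra.Properties.Group G
  open import Algebra.Solver.Monoid monoid using (solve; _⊜_; _⊕_; Expr)
  open import Relation.Binary.Reasoning.Setoid setoid

  private
    variable
      x y a b d : Carrier

    -- The solver's _⊕_ is right-associative; its terms must mirror the left-nested _∙_ of the goals.
    infixl 7 _⊗_
    _⊗_ : ∀ {m} → Expr m → Expr m → Expr m
    e ⊗ e′ = e ⊕ e′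

  infix 8 _^_
  _^_ : Carrier → Carrier → Carrier
  x ^ b = b ⁻¹ ∙ x ∙ b

  [_,_] : Carrier → Carrier → Carrier
  [ a , b ] = a ⁻¹ ∙ b ⁻¹ ∙ a ∙ b

  Central : Carrier → Set (c ⊔ ℓ)
  Central g = ∀ h → g ∙ h ≈ h ∙ g

  []-cong : x ≈ a → y ≈ b → [ x , y ] ≈ [ a , b ]
  []-cong p q = ∙-cong (∙-cong (∙-cong (⁻¹-cong p) (⁻¹-cong q)) p) q

  []-inverse : ∀ a b → [ a , b ] ⁻¹ ≈ [ b , a ]
  []-inverse a b = begin
    (a ⁻¹ ∙ b ⁻¹ ∙ a ∙ b) ⁻¹             ≈⟨ ⁻¹-anti-homo-∙ _ b ⟩
    b ⁻¹ ∙ (a ⁻¹ ∙ b ⁻¹ ∙ a) ⁻¹          ≈⟨ ∙-congˡ (⁻¹-anti-homo-∙ _ a) ⟩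
    b ⁻¹ ∙ (a ⁻¹ ∙ (a ⁻¹ ∙ b ⁻¹) ⁻¹)     ≈⟨ ∙-congˡ (∙-congˡ (⁻¹-anti-homo-∙ _ _)) ⟩
    b ⁻¹ ∙ (a ⁻¹ ∙ (b ⁻¹ ⁻¹ ∙ a ⁻¹ ⁻¹))  ≈⟨ ∙-congˡ (∙-congˡ (∙-cong (⁻¹-involutive b) (⁻¹-involutive a))) ⟩
    b ⁻¹ ∙ (a ⁻¹ ∙ (b ∙ a))
      ≈⟨ solve 4 (λ b′ a′ b a → b′ ⊗ (a′ ⊗ (b ⊗ a)) ⊜ b′ ⊗ a′ ⊗ b ⊗ a) refl (b ⁻¹) (a ⁻¹) b a ⟩
    [ b , a ]                            ∎

  []-∙ˡ : ∀ a b d → [ a ∙ b , d ] ≈ [ a , d ] ^ b ∙ [ b , d ]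
  []-∙ˡ a b d = sym (begin
    b ⁻¹ ∙ (a ⁻¹ ∙ d ⁻¹ ∙ a ∙ d) ∙ b ∙ (b ⁻¹ ∙ d ⁻¹ ∙ b ∙ d)
      ≈⟨ solve 6 (λ a′ b′ d′ a b d → b′ ⊗ (a′ ⊗ d′ ⊗ a ⊗ d) ⊗ b ⊗ (b′ ⊗ d′ ⊗ b ⊗ d)
                                    ⊜ b′ ⊗ a′ ⊗ d′ ⊗ a ⊗ d ⊗ (b ⊗ (b′ ⊗ (d′ ⊗ b ⊗ d))))
               refl (a ⁻¹) (b ⁻¹) (d ⁻¹) a b d ⟩
    b ⁻¹ ∙ a ⁻¹ ∙ d ⁻¹ ∙ a ∙ d ∙ (b ∙ (b ⁻¹ ∙ (d ⁻¹ ∙ b ∙ d)))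
      ≈⟨ ∙-congˡ (\\-leftDividesˡ b _) ⟩
    b ⁻¹ ∙ a ⁻¹ ∙ d ⁻¹ ∙ a ∙ d ∙ (d ⁻¹ ∙ b ∙ d)
      ≈⟨ solve 6 (λ a′ b′ d′ a b d → b′ ⊗ a′ ⊗ d′ ⊗ a ⊗ d ⊗ (d′ ⊗ b ⊗ d)
                                    ⊜ b′ ⊗ a′ ⊗ d′ ⊗ a ⊗ (d ⊗ (d′ ⊗ (b ⊗ d))))
               refl (a ⁻¹) (b ⁻¹) (d ⁻¹) a b d ⟩
    b ⁻¹ ∙ a ⁻¹ ∙ d ⁻¹ ∙ a ∙ (d ∙ (d ⁻¹ ∙ (b ∙ d)))
      ≈⟨ ∙-congˡ (\\-leftDividesˡ d _) ⟩
    b ⁻¹ ∙ a ⁻¹ ∙ d ⁻¹ ∙ a ∙ (b ∙ d)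
      ≈⟨ solve 6 (λ a′ b′ d′ a b d → b′ ⊗ a′ ⊗ d′ ⊗ a ⊗ (b ⊗ d) ⊜ (b′ ⊗ a′) ⊗ d′ ⊗ (a ⊗ b) ⊗ d)
               refl (a ⁻¹) (b ⁻¹) (d ⁻¹) a b d ⟩
    (b ⁻¹ ∙ a ⁻¹) ∙ d ⁻¹ ∙ (a ∙ b) ∙ d
      ≈⟨ ∙-congʳ (∙-congʳ (∙-congʳ (⁻¹-anti-homo-∙ a b))) ⟨
    [ a ∙ b , d ] ∎)

  []-∙ʳ : ∀ a b d → [ a , b ∙ d ] ≈ [ a , d ] ∙ [ a , b ] ^ d
  []-∙ʳ a b d = sym (begin
    a ⁻¹ ∙ d ⁻¹ ∙ a ∙ d ∙ (d ⁻¹ ∙ (a ⁻¹ ∙ b ⁻¹ ∙ a ∙ b) ∙ d)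
      ≈⟨ solve 6 (λ a′ b′ d′ a b d → a′ ⊗ d′ ⊗ a ⊗ d ⊗ (d′ ⊗ (a′ ⊗ b′ ⊗ a ⊗ b) ⊗ d)
                                    ⊜ a′ ⊗ d′ ⊗ a ⊗ (d ⊗ (d′ ⊗ (a′ ⊗ b′ ⊗ a ⊗ b ⊗ d))))
               refl (a ⁻¹) (b ⁻¹) (d ⁻¹) a b d ⟩
    a ⁻¹ ∙ d ⁻¹ ∙ a ∙ (d ∙ (d ⁻¹ ∙ (a ⁻¹ ∙ b ⁻¹ ∙ a ∙ b ∙ d)))
      ≈⟨ ∙-congˡ (\\-leftDividesˡ d _) ⟩
    a ⁻¹ ∙ d ⁻¹ ∙ a ∙ (a ⁻¹ ∙ b ⁻¹ ∙ a ∙ b ∙ d)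
      ≈⟨ solve 6 (λ a′ b′ d′ a b d → a′ ⊗ d′ ⊗ a ⊗ (a′ ⊗ b′ ⊗ a ⊗ b ⊗ d)
                                    ⊜ a′ ⊗ d′ ⊗ (a ⊗ (a′ ⊗ (b′ ⊗ a ⊗ (b ⊗ d)))))
               refl (a ⁻¹) (b ⁻¹) (d ⁻¹) a b d ⟩
    a ⁻¹ ∙ d ⁻¹ ∙ (a ∙ (a ⁻¹ ∙ (b ⁻¹ ∙ a ∙ (b ∙ d))))
      ≈⟨ ∙-congˡ (\\-leftDividesˡ a _) ⟩
    a ⁻¹ ∙ d ⁻¹ ∙ (b ⁻¹ ∙ a ∙ (b ∙ d))
      ≈⟨ solve 6 (λ a′ b′ d′ a b d → a′ ⊗ d′ ⊗ (b′ ⊗ a ⊗ (b ⊗ d)) ⊜ a′ ⊗ (d′ ⊗ b′) ⊗ a ⊗ (b ⊗ d))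
               refl (a ⁻¹) (b ⁻¹) (d ⁻¹) a b d ⟩
    a ⁻¹ ∙ (d ⁻¹ ∙ b ⁻¹) ∙ a ∙ (b ∙ d)
      ≈⟨ ∙-congʳ (∙-congʳ (∙-congˡ (⁻¹-anti-homo-∙ b d))) ⟨
    [ a , b ∙ d ] ∎)

  ^≈∙[] : ∀ x b → x ^ b ≈ x ∙ [ x , b ]
  ^≈∙[] x b = sym (begin
    x ∙ (x ⁻¹ ∙ b ⁻¹ ∙ x ∙ b)
      ≈⟨ solve 4 (λ x′ b′ x b → x ⊗ (x′ ⊗ b′ ⊗ x ⊗ b) ⊜ x ⊗ (x′ ⊗ (b′ ⊗ x ⊗ b))) refl (x ⁻¹) (b ⁻¹) x b ⟩
    x ∙ (x ⁻¹ ∙ (b ⁻¹ ∙ x ∙ b))    ≈⟨ \\-leftDividesˡ x _ ⟩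
    x ^ b                          ∎)

  ^≈⇒[]≈ε : x ^ b ≈ x → [ x , b ] ≈ ε
  ^≈⇒[]≈ε {x} {b} p = begin
    [ x , b ]                 ≈⟨ \\-leftDividesʳ x _ ⟨
    x ⁻¹ ∙ (x ∙ [ x , b ])    ≈⟨ ∙-congˡ (^≈∙[] x b) ⟨
    x ⁻¹ ∙ x ^ b              ≈⟨ ∙-congˡ p ⟩
    x ⁻¹ ∙ x                  ≈⟨ inverseˡ x ⟩
    ε                         ∎

  []≈ε⇒∙-comm : [ x , y ] ≈ ε → x ∙ y ≈ y ∙ x
  []≈ε⇒∙-comm {x} {y} p = begin
    x ∙ y               ≈⟨ inverseʳ-unique (x ⁻¹ ∙ y ⁻¹) (x ∙ y) (trans (sym (assoc _ x y)) p) ⟩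
    (x ⁻¹ ∙ y ⁻¹) ⁻¹    ≈⟨ ⁻¹-anti-homo-∙ _ _ ⟩
    y ⁻¹ ⁻¹ ∙ x ⁻¹ ⁻¹   ≈⟨ ∙-cong (⁻¹-involutive y) (⁻¹-involutive x) ⟩
    y ∙ x               ∎

  ∙≈ε⇒⁻¹∙⁻¹≈ε : x ∙ x ≈ ε → x ⁻¹ ∙ x ⁻¹ ≈ ε
  ∙≈ε⇒⁻¹∙⁻¹≈ε {x} p = trans (sym (⁻¹-anti-homo-∙ x x)) (trans (⁻¹-cong p) ε⁻¹≈ε)

  [[x,y],x]≈ε : x ∙ x ≈ ε → [ x , y ] ∙ [ x , y ] ≈ ε → [ [ x , y ] , x ] ≈ ε
  [[x,y],x]≈ε {x} {y} x²≈ε c²≈ε = ^≈⇒[]≈ε (begin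
    x ⁻¹ ∙ (x ⁻¹ ∙ y ⁻¹ ∙ x ∙ y) ∙ x
      ≈⟨ solve 4 (λ x′ y′ x y → x′ ⊗ (x′ ⊗ y′ ⊗ x ⊗ y) ⊗ x ⊜ x′ ⊗ x′ ⊗ (y′ ⊗ x ⊗ y ⊗ x)) refl (x ⁻¹) (y ⁻¹) x y ⟩
    x ⁻¹ ∙ x ⁻¹ ∙ (y ⁻¹ ∙ x ∙ y ∙ x)   ≈⟨ ∙-congʳ (∙≈ε⇒⁻¹∙⁻¹≈ε x²≈ε) ⟩
    ε ∙ (y ⁻¹ ∙ x ∙ y ∙ x)             ≈⟨ identityˡ _ ⟩
    y ⁻¹ ∙ x ∙ y ∙ x                   ≈⟨ ∙-congʳ (∙-congʳ (∙-congˡ (inverseʳ-unique x x x²≈ε))) ⟩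
    [ y , x ]                          ≈⟨ []-inverse x y ⟨
    [ x , y ] ⁻¹                       ≈⟨ inverseʳ-unique _ _ c²≈ε ⟨
    [ x , y ]                          ∎)

  Central-resp : x ≈ y → Central x → Central y
  Central-resp {x} {y} p cx h = begin
    y ∙ h  ≈⟨ ∙-congʳ p ⟨
    x ∙ h  ≈⟨ cx h ⟩
    h ∙ x  ≈⟨ ∙-congˡ p ⟩
    h ∙ y  ∎

  Central-ε : Central ε
  Central-ε h = trans (identityˡ h) (sym (identityʳ h))

  Central-∙ : Central x → Central y → Central (x ∙ y)
  Central-∙ {x} {y} cx cy h = begin
    x ∙ y ∙ h    ≈⟨ assoc _ _ _ ⟩
    x ∙ (y ∙ h)  ≈⟨ ∙-congˡ (cy h) ⟩
    x ∙ (h ∙ y)  ≈⟨ assoc _ _ _ ⟨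
    x ∙ h ∙ y    ≈⟨ ∙-congʳ (cx h) ⟩
    h ∙ x ∙ y    ≈⟨ assoc _ _ _ ⟩
    h ∙ (x ∙ y)  ∎

  Central-⁻¹ : Central x → Central (x ⁻¹)
  Central-⁻¹ {x} cx h = begin
    x ⁻¹ ∙ h                ≈⟨ //-rightDividesʳ x _ ⟨
    x ⁻¹ ∙ h ∙ x ∙ x ⁻¹     ≈⟨ ∙-congʳ (assoc _ _ _) ⟩
    x ⁻¹ ∙ (h ∙ x) ∙ x ⁻¹   ≈⟨ ∙-congʳ (∙-congˡ (cx h)) ⟨
    x ⁻¹ ∙ (x ∙ h) ∙ x ⁻¹   ≈⟨ ∙-congʳ (\\-leftDividesʳ x h) ⟩
    h ∙ x ⁻¹                ∎

  Central⇒^≈ : Central x → ∀ b → x ^ b ≈ x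
  Central⇒^≈ {x} cx b = trans (∙-congʳ (sym (cx (b ⁻¹)))) (//-rightDividesˡ b x)

  Central⇒[]≈ε : Central x → ∀ b → [ x , b ] ≈ ε
  Central⇒[]≈ε cx b = ^≈⇒[]≈ε (Central⇒^≈ cx b)

  [ε,x]≈ε : ∀ x → [ ε , x ] ≈ ε
  [ε,x]≈ε = Central⇒[]≈ε Central-ε

  Central₂ : Carrier → Set (c ⊔ ℓ)
  Central₂ g = ∀ h → Central [ g , h ]

  Central⇒Central₂ : Central x → Central₂ x
  Central⇒Central₂ cx h = Central-resp (sym (Central⇒[]≈ε cx h)) Central-ε

  record IsNormalSubgroup {p} (N : Carrier → Set p) : Set (c ⊔ ℓ ⊔ p) where
    field
      resp      : x ≈ y → N x → N y
      ε-closed  : N ε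
      ∙-closed  : N x → N y → N (x ∙ y)
      ⁻¹-closed : N x → N (x ⁻¹)
      ^-closed  : N x → ∀ b → N (x ^ b)

    [,∙]-closed : N [ a , b ] → N [ a , d ] → N [ a , b ∙ d ]
    [,∙]-closed {a} {b} {d} p q = resp (sym ([]-∙ʳ a b d)) (∙-closed q (^-closed p d))

    [,ε]-closed : ∀ a → N [ a , ε ]
    [,ε]-closed a = resp (begin
      ε             ≈⟨ ε⁻¹≈ε ⟨
      ε ⁻¹          ≈⟨ ⁻¹-cong ([ε,x]≈ε a) ⟨
      [ ε , a ] ⁻¹  ≈⟨ []-inverse ε a ⟩
      [ a , ε ]     ∎) ε-closed

  isNormalSubgroup-trivial : IsNormalSubgroup (_≈ ε)
  isNormalSubgroup-trivial = record
    { resp      = λ p q → trans (sym p) q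
    ; ε-closed  = refl
    ; ∙-closed  = λ p q → trans (∙-cong p q) (identityˡ ε)
    ; ⁻¹-closed = λ p → trans (⁻¹-cong p) ε⁻¹≈ε
    ; ^-closed  = λ p b → trans (Central⇒^≈ (Central-resp (sym p) Central-ε) b) p
    }

  isNormalSubgroup-Central : IsNormalSubgroup Central
  isNormalSubgroup-Central = record
    { resp      = Central-resp
    ; ε-closed  = Central-ε
    ; ∙-closed  = Central-∙
    ; ⁻¹-closed = Central-⁻¹
    ; ^-closed  = λ cx b → Central-resp (sym (Central⇒^≈ cx b)) cx
    }

  isNormalSubgroup-Central₂ : IsNormalSubgroup Central₂
  isNormalSubgroup-Central₂ = record
    { resp      = λ p s h → Central-resp ([]-cong p refl) (s h)
    ; ε-closed  = Central⇒Central₂ Central-ε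
    ; ∙-closed  = ∙-closed
    ; ⁻¹-closed = ⁻¹-closed
    ; ^-closed  = ^-closed
    }
    where
    []-∙ˡ-central : Central₂ x → ∀ y h → [ x ∙ y , h ] ≈ [ x , h ] ∙ [ y , h ]
    []-∙ˡ-central {x} s y h = trans ([]-∙ˡ x y h) (∙-congʳ (Central⇒^≈ (s h) y))

    ∙-closed : Central₂ x → Central₂ y → Central₂ (x ∙ y)
    ∙-closed {x} {y} s t h = Central-resp (sym ([]-∙ˡ-central s y h)) (Central-∙ (s h) (t h))

    ⁻¹-closed : Central₂ x → Central₂ (x ⁻¹)
    ⁻¹-closed {x} s h = Central-resp (sym [x⁻¹,h]≈[x,h]⁻¹) (Central-⁻¹ (s h))
      where
      [x⁻¹,h]≈[x,h]⁻¹ : [ x ⁻¹ , h ] ≈ [ x , h ] ⁻¹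
      [x⁻¹,h]≈[x,h]⁻¹ = inverseʳ-unique _ _ (begin
        [ x , h ] ∙ [ x ⁻¹ , h ]   ≈⟨ []-∙ˡ-central s (x ⁻¹) h ⟨
        [ x ∙ x ⁻¹ , h ]           ≈⟨ []-cong (inverseʳ x) refl ⟩
        [ ε , h ]                  ≈⟨ [ε,x]≈ε h ⟩
        ε                          ∎)

    ^-closed : Central₂ x → ∀ b → Central₂ (x ^ b)
    ^-closed {x} s b h =
      Central-resp ([]-cong (sym (^≈∙[] x b)) refl) (∙-closed s (Central⇒Central₂ (s b)) h)

-- Opened only here: Defs exports its own Central, which would clash with the one above.
open import Defs

module PresentedGroup (n : ℕ) where
  ≈-setoid : Setoid _ _
  ≈-setoid = record
    { Carrier       = Word n
    ; _≈_           = _≈_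
    ; isEquivalence = record { refl = ≈-refl ; sym = ≈-sym ; trans = ≈-trans }
    }

  open import Relation.Binary.Reasoning.Setoid ≈-setoid

  ≡⇒≈ : {a b : Word n} → a ≡ b → a ≈ b
  ≡⇒≈ ≡.refl = ≈-refl

  inv-∷ : ∀ (l : Letter n) a → inv (l ∷ a) ≡ inv a · (flipL l ∷ [])
  inv-∷ l a = unfold-reverse (flipL l) (map flipL a)

  flipL-involutive : (l : Letter n) → flipL (flipL l) ≡ l
  flipL-involutive (z , b) = ≡.cong (z ,_) (not-involutive b)

  ·-inverseʳ : (a : Word n) → a · inv a ≈ ε
  ·-inverseʳ []      = ≈-refl
  ·-inverseʳ (l ∷ a) = begin
    (l ∷ []) · (a · inv (l ∷ a))             ≡⟨ ≡.cong (λ w → (l ∷ []) · (a · w)) (inv-∷ l a) ⟩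
    (l ∷ []) · (a · (inv a · (l′ ∷ [])))     ≡⟨ ≡.cong ((l ∷ []) ·_) (++-assoc a (inv a) _) ⟨
    (l ∷ []) · (a · inv a · (l′ ∷ []))       ≈⟨ ≈-cong (≈-refl {a = l ∷ []}) (≈-cong (·-inverseʳ a) (≈-refl {a = l′ ∷ []})) ⟩
    (l ∷ l′ ∷ [])                            ≈⟨ ≈-free l ⟩
    ε                                        ∎
    where l′ = flipL l

  ·-inverseˡ : (a : Word n) → inv a · a ≈ ε
  ·-inverseˡ []      = ≈-refl
  ·-inverseˡ (l ∷ a) = begin
    inv (l ∷ a) · ((l ∷ []) · a)             ≡⟨ ≡.cong (λ w → w · ((l ∷ []) · a)) (inv-∷ l a) ⟩
    inv a · (l′ ∷ []) · ((l ∷ []) · a)       ≡⟨ ++-assoc (inv a) (l′ ∷ []) _ ⟩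
    inv a · ((l′ ∷ l ∷ []) · a)              ≡⟨ ≡.cong (λ m → inv a · ((l′ ∷ m ∷ []) · a)) (flipL-involutive l) ⟨
    inv a · ((l′ ∷ flipL l′ ∷ []) · a)       ≈⟨ ≈-cong (≈-refl {a = inv a}) (≈-cong (≈-free l′) (≈-refl {a = a})) ⟩
    inv a · a                                ≈⟨ ·-inverseˡ a ⟩
    ε                                        ∎
    where l′ = flipL l

  inv-cong : {a b : Word n} → a ≈ b → inv a ≈ inv b
  inv-cong {a} {b} a≈b = begin
    inv a                  ≡⟨ ++-identityʳ (inv a) ⟨
    inv a · ε              ≈⟨ ≈-cong (≈-refl {a = inv a}) (·-inverseʳ b) ⟨
    inv a · (b · inv b)    ≡⟨ ++-assoc (inv a) b (inv b) ⟨
    inv a · b · inv b      ≈⟨ ≈-cong (≈-cong (≈-refl {a = inv a}) a≈b) (≈-refl {a = inv b}) ⟨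
    inv a · a · inv b      ≈⟨ ≈-cong (·-inverseˡ a) (≈-refl {a = inv b}) ⟩
    inv b                  ∎

  group : Group _ _
  group = record
    { Carrier = Word n
    ; _≈_     = _≈_
    ; _∙_     = _·_
    ; ε       = ε
    ; _⁻¹     = inv
    ; isGroup = record
      { isMonoid = record
        { isSemigroup = record
          { isMagma = record
            { isEquivalence = Setoid.isEquivalence ≈-setoid
            ; ∙-cong        = ≈-cong
            }
          ; assoc = λ a b c → ≡⇒≈ (++-assoc a b c)
          }
        ; identity = (λ _ → ≈-refl) , (λ a → ≡⇒≈ (++-identityʳ a))
        }
      ; inverse = ·-inverseˡ , ·-inverseʳ
      ; ⁻¹-cong = inv-cong
      }
    }

  open CommutatorCalculus group hiding (Central)
  open import Algebra.Properties.Group group using (inverseʳ-unique)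

  letter≈gen : (l : Letter n) → (l ∷ []) ≈ gen (proj₁ l)
  letter≈gen (z , true)  = ≈-refl
  letter≈gen (z , false) = ≈-sym (inverseʳ-unique (gen z) (gen z) (≈-rel (r-sq z)))

  module _ {p} {N : Word n → Set p} (N-normal : IsNormalSubgroup N) where
    open IsNormalSubgroup N-normal

    [g,gen]∈N⇒[g,h]∈N : ∀ g → (∀ z → N [ g , gen z ]) → ∀ h → N [ g , h ]
    [g,gen]∈N⇒[g,h]∈N g [g,gen]∈N []      = [,ε]-closed g
    [g,gen]∈N⇒[g,h]∈N g [g,gen]∈N (l ∷ h) =
      [,∙]-closed {a = g} {b = l ∷ []}
        (resp ([]-cong (≈-refl {a = g}) (≈-sym (letter≈gen l))) ([g,gen]∈N (proj₁ l)))
        ([g,gen]∈N⇒[g,h]∈N g [g,gen]∈N h)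

    LCS-least : ∀ {k} → (∀ {g} → LCS (suc k) g → ∀ h → N [ g , h ]) →
                ∀ {g} → LCS (suc (suc k)) g → N g
    LCS-least [H,H]⊆N (lcs-comm p h)  = [H,H]⊆N p h
    LCS-least [H,H]⊆N lcs-unit        = ε-closed
    LCS-least [H,H]⊆N (lcs-mul p q)   = ∙-closed (LCS-least [H,H]⊆N p) (LCS-least [H,H]⊆N q)
    LCS-least [H,H]⊆N (lcs-inv p)     = ⁻¹-closed (LCS-least [H,H]⊆N p)
    LCS-least [H,H]⊆N (lcs-resp e p)  = resp e (LCS-least [H,H]⊆N p)

  [gen,gen]²≈ε : ∀ z z′ → sq [ gen z , gen z′ ] ≈ ε
  [gen,gen]²≈ε (inj₁ i) (inj₁ j) = ≈-cong (≈-rel (r-xx i j)) (≈-rel (r-xx i j))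
  [gen,gen]²≈ε (inj₂ i) (inj₂ j) = ≈-cong (≈-rel (r-yy i j)) (≈-rel (r-yy i j))
  [gen,gen]²≈ε (inj₁ i) (inj₂ j) = ≈-rel (r-xy² i j)
  [gen,gen]²≈ε (inj₂ j) (inj₁ i) =
    ≈-trans (≈-cong [y,x]≈[x,y]⁻¹ [y,x]≈[x,y]⁻¹) (∙≈ε⇒⁻¹∙⁻¹≈ε {x = [ X i , Y j ]} (≈-rel (r-xy² i j)))
    where
    [y,x]≈[x,y]⁻¹ : [ Y j , X i ] ≈ inv [ X i , Y j ]
    [y,x]≈[x,y]⁻¹ = ≈-sym ([]-inverse (X i) (Y j))

  [gen,gen]-comm : ∀ z z′ → [ gen z , gen z′ ] ≈ [ gen z′ , gen z ]
  [gen,gen]-comm z z′ =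
    ≈-trans (inverseʳ-unique [ gen z , gen z′ ] _ ([gen,gen]²≈ε z z′)) ([]-inverse (gen z) (gen z′))

  [[gen,gen],gen]≈ε : ∀ z z′ → [ [ gen z , gen z′ ] , gen z ] ≈ ε
  [[gen,gen],gen]≈ε z z′ = [[x,y],x]≈ε {x = gen z} {y = gen z′} (≈-rel (r-sq z)) ([gen,gen]²≈ε z z′)

  [[gen,gen′],gen′]≈ε : ∀ z z′ → [ [ gen z , gen z′ ] , gen z′ ] ≈ ε
  [[gen,gen′],gen′]≈ε z z′ =
    ≈-trans ([]-cong ([gen,gen]-comm z z′) (≈-refl {a = gen z′})) ([[gen,gen],gen]≈ε z′ z)

  [[gen,gen],gen]-central : ∀ z z′ z″ → Central [ [ gen z , gen z′ ] , gen z″ ]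
  [[gen,gen],gen]-central z z′ z″ h =
    []≈ε⇒∙-comm {x = c} ([g,gen]∈N⇒[g,h]∈N isNormalSubgroup-trivial c (λ z‴ → ≈-rel (r-4 z z′ z″ z‴)) h)
    where c = [ [ gen z , gen z′ ] , gen z″ ]

  c≈ε⇒[c,gen]²≈ε : ∀ {c} z → c ≈ ε → sq [ c , gen z ] ≈ ε
  c≈ε⇒[c,gen]²≈ε z c≈ε = ≈-cong [c,z]≈ε [c,z]≈ε
    where [c,z]≈ε = ≈-trans ([]-cong c≈ε ≈-refl) ([ε,x]≈ε (gen z))

  [[gen,gen],gen]²≈ε : ∀ z z′ z″ → sq [ [ gen z , gen z′ ] , gen z″ ] ≈ ε
  [[gen,gen],gen]²≈ε (inj₁ i) (inj₁ j) z″ = c≈ε⇒[c,gen]²≈ε z″ (≈-rel (r-xx i j))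
  [[gen,gen],gen]²≈ε (inj₂ i) (inj₂ j) z″ = c≈ε⇒[c,gen]²≈ε z″ (≈-rel (r-yy i j))
  [[gen,gen],gen]²≈ε (inj₁ i) (inj₂ j) z″ = ≈-rel (r-xyz² i j z″)
  [[gen,gen],gen]²≈ε (inj₂ j) (inj₁ i) z″ =
    ≈-trans (≈-cong [[y,x],z]≈[[x,y],z] [[y,x],z]≈[[x,y],z]) (≈-rel (r-xyz² i j z″))
    where
    [[y,x],z]≈[[x,y],z] : [ [ Y j , X i ] , gen z″ ] ≈ [ [ X i , Y j ] , gen z″ ]
    [[y,x],z]≈[[x,y],z] = []-cong ([gen,gen]-comm (inj₂ j) (inj₁ i)) (≈-refl {a = gen z″})

  [gen,gen]∈Z₂ : ∀ z z′ → Central₂ [ gen z , gen z′ ]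
  [gen,gen]∈Z₂ z z′ =
    [g,gen]∈N⇒[g,h]∈N isNormalSubgroup-Central [ gen z , gen z′ ] ([[gen,gen],gen]-central z z′)

  [gen,h]∈Z₂ : ∀ z h → Central₂ [ gen z , h ]
  [gen,h]∈Z₂ z = [g,gen]∈N⇒[g,h]∈N isNormalSubgroup-Central₂ (gen z) ([gen,gen]∈Z₂ z)

  [g,h]∈Z₂ : ∀ g h → Central₂ [ g , h ]
  [g,h]∈Z₂ g = [g,gen]∈N⇒[g,h]∈N isNormalSubgroup-Central₂ g
    (λ z → resp {x = inv [ gen z , g ]} ([]-inverse (gen z) g)
                (⁻¹-closed {x = [ gen z , g ]} ([gen,h]∈Z₂ z g)))
    where open IsNormalSubgroup isNormalSubgroup-Central₂

  LCS₂⊆Z₂ : ∀ {g} → LCS 2 g → Central₂ g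
  LCS₂⊆Z₂ = LCS-least isNormalSubgroup-Central₂ (λ {g} _ → [g,h]∈Z₂ g)

  LCS₃⊆Z : ∀ {g} → LCS 3 g → Central g
  LCS₃⊆Z = LCS-least isNormalSubgroup-Central LCS₂⊆Z₂

  LCS₄≈ε : ∀ {g} → LCS 4 g → g ≈ ε
  LCS₄≈ε = LCS-least isNormalSubgroup-trivial (λ p → Central⇒[]≈ε (LCS₃⊆Z p))

lemma4p2 : (n : ℕ) → 2 ≤ n →
    (∀ (z z′ : Gen n) →
      (comm (comm (gen z) (gen z′)) (gen z) ≈ ε)
      × (comm (comm (gen z) (gen z′)) (gen z′) ≈ ε))
    × (∀ (z z′ z″ : Gen n) →
      Central (comm (comm (gen z) (gen z′)) (gen z″))
      × (comm (gen z) (gen z′) ≈ comm (gen z′) (gen z))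
      × (sq (comm (gen z) (gen z′)) ≈ ε)
      × (sq (comm (comm (gen z) (gen z′)) (gen z″)) ≈ ε))
    × (∀ (g : Word n) → LCS 4 g → g ≈ ε)
lemma4p2 n _ =
  (λ z z′ → [[gen,gen],gen]≈ε z z′ , [[gen,gen′],gen′]≈ε z z′) ,
  (λ z z′ z″ → [[gen,gen],gen]-central z z′ z″ , [gen,gen]-comm z z′ ,
               [gen,gen]²≈ε z z′ , [[gen,gen],gen]²≈ε z z′ z″) ,
  (λ _ → LCS₄≈ε)
  where open PresentedGroup n
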